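{- For all integers $n\ge 3$ and $0\le r\le n$, $N_1^{n,r}=2N_0^{n,r}$; that is, exactly twice as many ordered pairs of walks from $(0,0)$ to $(r,n-r)$ have exactly one intersection point as have none.
   Context: A walk is a lattice path in $\mathbb{Z}^2$ using unit steps E $(+1,0)$ and N $(0,+1)$. For integers $0\le r\le n$, consider walks from $(0,0)$ to $(r,n-r)$. The number of intersection points of two such walks is the number of lattice points lying on both walks, excluding the initial vertex $(0,0)$ and the terminal vertex $(r,n-r)$. $N_k^{n,r}$ denotes the number of ordered pairs of such walks having exactly $k$ intersection points. -}

module Defs where

open import Data.Nat using (ℕ; zero; suc; _+_; _≟_)
open import Data.Bool using (Bool; true; false; if_then_else_)
open import Data.List using (List; []; _∷_; length; map; filter; concatMap; cartesianProduct; _++_)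
open import Data.List.Membership.DecPropositional using ()
open import Data.Product using (_×_; _,_; proj₁; proj₂)
open import Data.Product.Properties using (≡-dec)
open import Relation.Nullary using (Dec; yes; no; ¬?)
open import Relation.Nullary.Decidable using (⌊_⌋)
open import Relation.Binary.PropositionalEquality using (_≡_)
import Data.List.Membership.DecPropositional as DecMem

-- A step: true = E (+1,0), false = N (0,+1).
Step : Set
Step = Bool

-- Lattice points in the first quadrant suffice (walks only move E/N from the origin).
Point : Set
Point = ℕ × ℕ

_≟ᴾ_ : (p q : Point) → Dec (p ≡ q)
_≟ᴾ_ = ≡-dec _≟_ _≟_

step : Point → Step → Point
step (x , y) true  = (suc x , y)
step (x , y) false = (x , suc y)

words : ℕ → List (List Step)
words zero    = [] ∷ []
words (suc n) = map (true ∷_) (words n) ++ map (false ∷_) (words n)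

endFrom : Point → List Step → Point
endFrom p []       = p
endFrom p (s ∷ w)  = endFrom (step p s) w

walks : ℕ → ℕ → List (List Step)
walks n r = filter (λ w → endFrom (0 , 0) w ≟ᴾ (r , n Data.Nat.∸ r)) (words n)

visitedFrom : Point → List Step → List Point
visitedFrom p []      = []
visitedFrom p (s ∷ w) = step p s ∷ visitedFrom (step p s) w

vertices : List Step → List Point
vertices w = (0 , 0) ∷ visitedFrom (0 , 0) w

-- Number of intersection points of two walks ending at `e`: lattice points
-- on both walks, excluding the start (0,0) and the terminal vertex e.
-- (Vertices of an E/N walk are pairwise distinct, so counting vertices of the
-- first walk counts lattice points.)
intersections : Point → List Step → List Step → ℕ
intersections e w₁ w₂ =
  length (filter (λ p → DecMem._∈?_ _≟ᴾ_ p (vertices w₂))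
           (filter (λ p → ¬? (p ≟ᴾ e))
             (filter (λ p → ¬? (p ≟ᴾ (0 , 0))) (vertices w₁))))

N : ℕ → ℕ → ℕ → ℕ
N k n r = length (filter (λ pr → intersections (r , n Data.Nat.∸ r) (proj₁ pr) (proj₂ pr) ≟ k)
                         (cartesianProduct (walks n r) (walks n r)))

module Submission where

-- Encode an ordered pair of walks of length n as a word over the four simultaneous steps
-- EE, EN, NE, NN, and follow the height x₁ − x₂ of the pair: the walks meet exactly where
-- the height is 0, so pairs ending together with k intersection points are bridges of the
-- height with k + 1 visits to 0 (counted jointly with the number r of east steps of the
-- first walk, which fixes the common endpoint). Splitting at the first visit to 0, the
-- pairs with one intersection form the convolution Z ⊛ Z of the excursions Z, the pairs
-- with none. An excursion is flat (a single EE or NN), positive (starts with EN) or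
-- negative (starts with NE), and exchanging the walks matches negative with positive
-- ones, so Z = F + 2P. A positive excursion is EN, a nonnegative bridge, NE, and
-- nonnegative bridges factor at their first return into nonnegative excursions F + P;
-- hence P ⊛ (F + P) = P in length at least 3. There F and F ⊛ F vanish, so
-- Z ⊛ Z = F ⊛ F + 4 P ⊛ F + 4 P ⊛ P = 4P = 2Z.

open import Defs
open import Data.Bool using (true; false; if_then_else_)
open import Data.Empty using (⊥-elim)
open import Data.Integer as ℤ using (ℤ; +0; +[1+_]; -[1+_]; 0ℤ; 1ℤ; -1ℤ; -_; _-_)
  renaming (suc to sucℤ; pred to predℤ)
import Data.Integer.Properties as ℤₚ
open ℤₚ using () renaming (_≟_ to _≟ℤ_)
import Data.Integer.Tactic.RingSolver as ℤ-Solver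
open import Data.List using (List; []; _∷_; [_]; length; take; drop; _++_; map; filter; cartesianProduct)
open import Data.List.Membership.Propositional using (_∈_)
open import Data.List.Membership.Propositional.Properties using (∈-++⁻; ∈-++⁺ʳ)
import Data.List.Membership.DecPropositional as DecMembership
open import Data.List.Properties
  using (length-map; map-++; map-∘; take++drop≡id; filter-accept; filter-reject; filter-all; ++-assoc)
open import Data.List.Relation.Unary.All using (tabulate)
open import Data.List.Relation.Unary.Any using (here; there)
open import Data.Nat using (ℕ; zero; suc; _+_; _*_; _∸_; _≤_; _<_; z≤n; s≤s; _≟_)
open import Data.Nat.ListAction using (sum)
open import Data.Nat.ListAction.Properties using (sum-++)
open import Data.Nat.Properties
open import Data.Nat.Tactic.RingSolver using (solve-∀)
open import Data.Product using (∃; _×_; _,_; proj₁; proj₂)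
open import Data.Sum using (inj₁; inj₂)
open import Function using (_∘_; id)
open import Level using (0ℓ)
open import Relation.Binary.PropositionalEquality hiding ([_])
open import Relation.Nullary using (Dec; yes; no; ¬_; ¬?; does)
open import Relation.Unary using (Pred; Decidable)

𝟙 : {A : Set} → Dec A → ℕ
𝟙 a? = if does a? then 1 else 0

𝟙-yes : {A : Set} (a? : Dec A) → A → 𝟙 a? ≡ 1
𝟙-yes (yes _) _ = refl
𝟙-yes (no ¬a) a = ⊥-elim (¬a a)

𝟙-no : {A : Set} (a? : Dec A) → ¬ A → 𝟙 a? ≡ 0
𝟙-no (yes a) ¬a = ⊥-elim (¬a a)
𝟙-no (no _)  _  = refl

𝟙-⇔ : {A B : Set} (a? : Dec A) (b? : Dec B) → (A → B) → (B → A) → 𝟙 a? ≡ 𝟙 b?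
𝟙-⇔ a? (yes b) _ g = 𝟙-yes a? (g b)
𝟙-⇔ a? (no ¬b) f _ = 𝟙-no a? (¬b ∘ f)

𝟙-guard : {A : Set} (a? : Dec A) {x y : ℕ} → (A → x ≡ y) → 𝟙 a? * x ≡ 𝟙 a? * y
𝟙-guard (yes a) x≡y = cong (_+ 0) (x≡y a)
𝟙-guard (no _)  _   = refl

δ : ℕ → ℕ → ℕ
δ m n = 𝟙 (m ≟ n)

δ-≢ : ∀ {x y} → x ≢ y → δ x y ≡ 0
δ-≢ {x} {y} = 𝟙-no (x ≟ y)

δ-refl : ∀ x → δ x x ≡ 1
δ-refl x = 𝟙-yes (x ≟ x) refl

sum≤ : ℕ → (ℕ → ℕ) → ℕ
sum≤ zero    f = f 0
sum≤ (suc n) f = f 0 + sum≤ n (f ∘ suc)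

infix 5 sum≤
syntax sum≤ n (λ i → e) = ∑[ i ≤ n ] e

sum≤-cong : ∀ n {f g : ℕ → ℕ} → (∀ i → i ≤ n → f i ≡ g i) → sum≤ n f ≡ sum≤ n g
sum≤-cong zero    f≡g = f≡g 0 z≤n
sum≤-cong (suc n) f≡g = cong₂ _+_ (f≡g 0 z≤n) (sum≤-cong n (λ i i≤n → f≡g (suc i) (s≤s i≤n)))

sum≤-zero : ∀ n {f : ℕ → ℕ} → (∀ i → f i ≡ 0) → sum≤ n f ≡ 0
sum≤-zero zero    f≡0 = f≡0 0
sum≤-zero (suc n) f≡0 = cong₂ _+_ (f≡0 0) (sum≤-zero n (f≡0 ∘ suc))

sum≤-head : ∀ n {f : ℕ → ℕ} → (∀ i → f (suc i) ≡ 0) → sum≤ n f ≡ f 0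
sum≤-head zero    _     = refl
sum≤-head (suc n) {f} tail≡0 = trans (cong (f 0 +_) (sum≤-zero n tail≡0)) (+-identityʳ _)

sum≤-+ : ∀ n (f g : ℕ → ℕ) → ∑[ i ≤ n ] (f i + g i) ≡ sum≤ n f + sum≤ n g
sum≤-+ zero    f g = refl
sum≤-+ (suc n) f g = trans (cong (f 0 + g 0 +_) (sum≤-+ n (f ∘ suc) (g ∘ suc))) (+-interchange (f 0) _ _ _)
  where
  +-interchange : ∀ a b c d → (a + b) + (c + d) ≡ (a + c) + (b + d)
  +-interchange = solve-∀

sum≤-*ˡ : ∀ n k (f : ℕ → ℕ) → ∑[ i ≤ n ] (k * f i) ≡ k * sum≤ n f
sum≤-*ˡ zero    k f = refl
sum≤-*ˡ (suc n) k f = trans (cong (k * f 0 +_) (sum≤-*ˡ n k (f ∘ suc))) (sym (*-distribˡ-+ k (f 0) _))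

sum≤-*ʳ : ∀ n k (f : ℕ → ℕ) → ∑[ i ≤ n ] (f i * k) ≡ sum≤ n f * k
sum≤-*ʳ n k f = trans (sum≤-cong n (λ i _ → *-comm (f i) k)) (trans (sum≤-*ˡ n k f) (*-comm k _))

sum≤-reverse : ∀ n (f : ℕ → ℕ) → sum≤ n f ≡ ∑[ i ≤ n ] f (n ∸ i)
sum≤-reverse zero    f = refl
sum≤-reverse (suc n) f = begin
  sum≤ (suc n) f                     ≡⟨ sum≤-snoc n f ⟩
  sum≤ n f + f (suc n)               ≡⟨ cong (_+ f (suc n)) (sum≤-reverse n f) ⟩
  (∑[ i ≤ n ] f (n ∸ i)) + f (suc n) ≡⟨ +-comm _ (f (suc n)) ⟩
  ∑[ i ≤ suc n ] f (suc n ∸ i)       ∎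
  where
  open ≡-Reasoning
  sum≤-snoc : ∀ n (f : ℕ → ℕ) → sum≤ (suc n) f ≡ sum≤ n f + f (suc n)
  sum≤-snoc zero    f = refl
  sum≤-snoc (suc n) f = trans (cong (f 0 +_) (sum≤-snoc n (f ∘ suc))) (sym (+-assoc (f 0) _ _))

δ-+ : ∀ x y r → δ (x + y) r ≡ ∑[ a ≤ r ] δ x a * δ y (r ∸ a)
δ-+ zero    y zero    = sym (+-identityʳ _)
δ-+ zero    y (suc r) = sym (trans (cong (δ y (suc r) + 0 +_) (sum≤-zero r (λ _ → refl)))
                                   (trans (+-identityʳ _) (+-identityʳ _)))
δ-+ (suc x) y zero    = refl
δ-+ (suc x) y (suc r) = δ-+ x y r

-- Pairs of walks as words of simultaneous steps

-- A letter is a step of the first walk together with a step of the second: EN means that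
-- the first walk goes east and the second north.
data Step² : Set where
  EE EN NE NN : Step²

first second : Step² → Step
first EE = true
first EN = true
first NE = false
first NN = false
second EE = true
second EN = false
second NE = true
second NN = false

swap : Step² → Step²
swap EE = EE
swap EN = NE
swap NE = EN
swap NN = NN

east : List Step → ℕ
east []          = 0
east (true ∷ a)  = suc (east a)
east (false ∷ a) = east a

walk₁ walk₂ : List Step² → List Step
walk₁ = map first
walk₂ = map second

east-++ : ∀ a b → east (a ++ b) ≡ east a + east b
east-++ []          b = refl
east-++ (true ∷ a)  b = cong suc (east-++ a b)
east-++ (false ∷ a) b = east-++ a b

east-take-drop : ∀ i w → east (walk₁ (take i w)) + east (walk₁ (drop i w)) ≡ east (walk₁ w)
east-take-drop i w = trans (sym (east-++ (walk₁ (take i w)) (walk₁ (drop i w))))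
  (cong east (trans (sym (map-++ first (take i w) (drop i w))) (cong walk₁ (take++drop≡id i w))))

east≤length : ∀ a → east a ≤ length a
east≤length []          = z≤n
east≤length (true ∷ a)  = s≤s (east≤length a)
east≤length (false ∷ a) = m≤n⇒m≤1+n (east≤length a)

∑Step² : (Step² → ℕ) → ℕ
∑Step² g = (g EE + g EN) + (g NE + g NN)

∑₂ : ℕ → (List Step² → ℕ) → ℕ
∑₂ zero    f = f []
∑₂ (suc n) f = ∑Step² (λ c → ∑₂ n (f ∘ (c ∷_)))

∑Step²-cong : {g h : Step² → ℕ} → (∀ c → g c ≡ h c) → ∑Step² g ≡ ∑Step² h
∑Step²-cong g≡h = cong₂ _+_ (cong₂ _+_ (g≡h EE) (g≡h EN)) (cong₂ _+_ (g≡h NE) (g≡h NN))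

∑Step²-+ : (g h : Step² → ℕ) → ∑Step² (λ c → g c + h c) ≡ ∑Step² g + ∑Step² h
∑Step²-+ g h = lemma (g EE) (h EE) (g EN) (h EN) (g NE) (h NE) (g NN) (h NN)
  where
  lemma : ∀ a a′ b b′ c c′ d d′ →
          ((a + a′) + (b + b′)) + ((c + c′) + (d + d′)) ≡ ((a + b) + (c + d)) + ((a′ + b′) + (c′ + d′))
  lemma = solve-∀

∑Step²-*ˡ : ∀ k (g : Step² → ℕ) → ∑Step² (λ c → k * g c) ≡ k * ∑Step² g
∑Step²-*ˡ k g = lemma k (g EE) (g EN) (g NE) (g NN)
  where
  lemma : ∀ k a b c d → (k * a + k * b) + (k * c + k * d) ≡ k * ((a + b) + (c + d))
  lemma = solve-∀

∑Step²-*ʳ : ∀ k (g : Step² → ℕ) → ∑Step² (λ c → g c * k) ≡ ∑Step² g * k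
∑Step²-*ʳ k g = trans (∑Step²-cong (λ c → *-comm (g c) k)) (trans (∑Step²-*ˡ k g) (*-comm k _))

∑Step²-swap : (g : Step² → ℕ) → ∑Step² (g ∘ swap) ≡ ∑Step² g
∑Step²-swap g = lemma (g EE) (g EN) (g NE) (g NN)
  where
  lemma : ∀ a b c d → (a + c) + (b + d) ≡ (a + b) + (c + d)
  lemma = solve-∀

∑₂-cong : ∀ n {f g : List Step² → ℕ} → (∀ w → length w ≡ n → f w ≡ g w) → ∑₂ n f ≡ ∑₂ n g
∑₂-cong zero    f≡g = f≡g [] refl
∑₂-cong (suc n) f≡g = ∑Step²-cong (λ c → ∑₂-cong n (λ w len → f≡g (c ∷ w) (cong suc len)))

∑₂-zero : ∀ n {f : List Step² → ℕ} → (∀ w → f w ≡ 0) → ∑₂ n f ≡ 0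
∑₂-zero zero    f≡0 = f≡0 []
∑₂-zero (suc n) f≡0 = ∑Step²-cong (λ c → ∑₂-zero n (λ w → f≡0 (c ∷ w)))

∑₂-+ : ∀ n (f g : List Step² → ℕ) → ∑₂ n (λ w → f w + g w) ≡ ∑₂ n f + ∑₂ n g
∑₂-+ zero    f g = refl
∑₂-+ (suc n) f g = trans (∑Step²-cong (λ c → ∑₂-+ n (f ∘ (c ∷_)) (g ∘ (c ∷_))))
                         (∑Step²-+ (λ c → ∑₂ n (f ∘ (c ∷_))) (λ c → ∑₂ n (g ∘ (c ∷_))))

∑₂-*ˡ : ∀ n k (f : List Step² → ℕ) → ∑₂ n (λ w → k * f w) ≡ k * ∑₂ n f
∑₂-*ˡ zero    k f = refl
∑₂-*ˡ (suc n) k f = trans (∑Step²-cong (λ c → ∑₂-*ˡ n k (f ∘ (c ∷_))))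
                          (∑Step²-*ˡ k (λ c → ∑₂ n (f ∘ (c ∷_))))

∑₂-sum≤ : ∀ n m (F : ℕ → List Step² → ℕ) →
          ∑₂ n (λ w → ∑[ i ≤ m ] F i w) ≡ ∑[ i ≤ m ] ∑₂ n (F i)
∑₂-sum≤ n zero    F = refl
∑₂-sum≤ n (suc m) F = trans (∑₂-+ n (F 0) _) (cong (∑₂ n (F 0) +_) (∑₂-sum≤ n m (F ∘ suc)))

∑₂-split : ∀ i j (F G : List Step² → ℕ) →
           ∑₂ (i + j) (λ w → F (take i w) * G (drop i w)) ≡ ∑₂ i F * ∑₂ j G
∑₂-split zero    j F G = ∑₂-*ˡ j (F []) G
∑₂-split (suc i) j F G =
  trans (∑Step²-cong (λ c → ∑₂-split i j (F ∘ (c ∷_)) G))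
        (∑Step²-*ʳ (∑₂ j G) (λ c → ∑₂ i (F ∘ (c ∷_))))

∑₂-split≤ : ∀ {i n} → i ≤ n → (F G : List Step² → ℕ) →
            ∑₂ n (λ w → F (take i w) * G (drop i w)) ≡ ∑₂ i F * ∑₂ (n ∸ i) G
∑₂-split≤ {i} i≤n F G =
  trans (cong (λ m → ∑₂ m (λ w → F (take i w) * G (drop i w))) (sym (m+[n∸m]≡n i≤n))) (∑₂-split i _ F G)

∑₂-++ : ∀ i j (g : List Step² → ℕ) → ∑₂ (i + j) g ≡ ∑₂ i (λ u → ∑₂ j (λ v → g (u ++ v)))
∑₂-++ zero    j g = refl
∑₂-++ (suc i) j g = ∑Step²-cong (λ c → ∑₂-++ i j (g ∘ (c ∷_)))

∑₂-swap : ∀ n (f : List Step² → ℕ) → ∑₂ n (f ∘ map swap) ≡ ∑₂ n f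
∑₂-swap zero    f = refl
∑₂-swap (suc n) f = trans (∑Step²-cong (λ c → ∑₂-swap n (f ∘ (swap c ∷_))))
                          (∑Step²-swap (λ c → ∑₂ n (f ∘ (c ∷_))))

-- The height of a pair of walks is x₁ − x₂ (see gap below); after equally many steps the
-- walks are at the same point exactly when it is 0.
shift : Step² → ℤ → ℤ
shift EE = id
shift EN = sucℤ
shift NE = predℤ
shift NN = id

height : ℤ → List Step² → ℤ
height h []      = h
height h (c ∷ w) = height (shift c h) w

visits : ℤ → ℤ → List Step² → ℕ
visits v h []      = 0
visits v h (c ∷ w) = 𝟙 (shift c h ≟ℤ v) + visits v (shift c h) w

height-++ : ∀ h u v → height h (u ++ v) ≡ height (height h u) v
height-++ h []      v = refl
height-++ h (c ∷ u) v = height-++ (shift c h) u v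

visits-++ : ∀ v h u u′ → visits v h (u ++ u′) ≡ visits v h u + visits v (height h u) u′
visits-++ v h []      u′ = refl
visits-++ v h (c ∷ u) u′ =
  trans (cong (𝟙 (shift c h ≟ℤ v) +_) (visits-++ v (shift c h) u u′))
        (sym (+-assoc (𝟙 (shift c h ≟ℤ v)) (visits v (shift c h) u) _))

shift-sucℤ : ∀ c h → shift c (sucℤ h) ≡ sucℤ (shift c h)
shift-sucℤ EE h = refl
shift-sucℤ EN h = refl
shift-sucℤ NE h = trans (ℤₚ.pred-suc h) (sym (ℤₚ.suc-pred h))
shift-sucℤ NN h = refl

height-sucℤ : ∀ h w → height (sucℤ h) w ≡ sucℤ (height h w)
height-sucℤ h []      = refl
height-sucℤ h (c ∷ w) = trans (cong (λ h′ → height h′ w) (shift-sucℤ c h)) (height-sucℤ (shift c h) w)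

visits-sucℤ : ∀ v h w → visits (sucℤ v) (sucℤ h) w ≡ visits v h w
visits-sucℤ v h []      = refl
visits-sucℤ v h (c ∷ w) rewrite shift-sucℤ c h =
  cong₂ _+_ (𝟙-⇔ (sucℤ (shift c h) ≟ℤ sucℤ v) (shift c h ≟ℤ v) sucℤ-injective (cong sucℤ))
            (visits-sucℤ v (shift c h) w)
  where
  sucℤ-injective : ∀ {i j} → sucℤ i ≡ sucℤ j → i ≡ j
  sucℤ-injective {i} {j} eq = trans (sym (ℤₚ.pred-suc i)) (trans (cong predℤ eq) (ℤₚ.pred-suc j))

shift-swap : ∀ c h → shift (swap c) (- h) ≡ - shift c h
shift-swap EE h = refl
shift-swap EN h = sym (ℤₚ.neg-distrib-+ 1ℤ h)
shift-swap NE h = sym (ℤₚ.neg-distrib-+ -1ℤ h)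
shift-swap NN h = refl

height-swap : ∀ h w → height (- h) (map swap w) ≡ - height h w
height-swap h []      = refl
height-swap h (c ∷ w) =
  trans (cong (λ h′ → height h′ (map swap w)) (shift-swap c h)) (height-swap (shift c h) w)

𝟙-neg : ∀ i j → 𝟙 (- i ≟ℤ - j) ≡ 𝟙 (i ≟ℤ j)
𝟙-neg i j = 𝟙-⇔ (- i ≟ℤ - j) (i ≟ℤ j) ℤₚ.neg-injective (cong (λ i → - i))

visits-swap : ∀ v h w → visits (- v) (- h) (map swap w) ≡ visits v h w
visits-swap v h []      = refl
visits-swap v h (c ∷ w) rewrite shift-swap c h =
  cong₂ _+_ (𝟙-neg (shift c h) v) (visits-swap v (shift c h) w)

ends-at-visited : ∀ v h w → 𝟙 (𝟙 (h ≟ℤ v) + visits v h w ≟ 0) * 𝟙 (height h w ≟ℤ v) ≡ 0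
ends-at-visited v h w with h ≟ℤ v
... | yes _ = refl
ends-at-visited v h []      | no h≢v = cong (_+ 0) (𝟙-no (h ≟ℤ v) h≢v)
ends-at-visited v h (c ∷ w) | no _   = ends-at-visited v (shift c h) w

height-nonneg : ∀ m w → visits -1ℤ (ℤ.+ m) w ≡ 0 → ∃ λ m′ → height (ℤ.+ m) w ≡ ℤ.+ m′
height-nonneg m       []       _      = m , refl
height-nonneg m       (EE ∷ w) avoids = height-nonneg m w avoids
height-nonneg m       (EN ∷ w) avoids = height-nonneg (suc m) w avoids
height-nonneg zero    (NE ∷ w) ()
height-nonneg (suc m) (NE ∷ w) avoids = height-nonneg m w avoids
height-nonneg m       (NN ∷ w) avoids = height-nonneg m w avoids

-- First-return decompositions

returns : ℤ → ℕ → List Step² → ℕ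
returns h j w = 𝟙 (visits 0ℤ h w ≟ j) * 𝟙 (height h w ≟ℤ 0ℤ)

meets : ℕ → List Step² → ℕ
meets = returns 0ℤ

meets-swap : ∀ j w → meets j (map swap w) ≡ meets j w
meets-swap j w = cong₂ _*_ (cong (λ k → 𝟙 (k ≟ j)) (visits-swap 0ℤ 0ℤ w))
                           (trans (cong (λ h → 𝟙 (h ≟ℤ 0ℤ)) (height-swap 0ℤ w)) (𝟙-neg (height 0ℤ w) 0ℤ))

meets-zero-prefix : ∀ w (g : ℕ → ℕ) → ∑[ i ≤ length w ] meets 0 (take i w) * g i ≡ g 0
meets-zero-prefix []      g = +-identityʳ (g 0)
meets-zero-prefix (c ∷ w) g =
  trans (sum≤-head (suc (length w)) {λ i → meets 0 (take i (c ∷ w)) * g i}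
                   (λ i → cong (_* g (suc i)) (ends-at-visited 0ℤ (shift c 0ℤ) (take i w))))
        (+-identityʳ (g 0))

returns-split : ∀ j h w → returns h (suc j) w ≡ ∑[ i ≤ length w ] returns h 1 (take i w) * meets j (drop i w)
returns-split j h []      = refl
returns-split j h (c ∷ w) = afterStep (shift c h)
  where
  -- Either the first step reaches 0, which is then the first return, or it does not and
  -- the first return of w from h′ is the one sought.
  afterStep : ∀ h′ → 𝟙 (𝟙 (h′ ≟ℤ 0ℤ) + visits 0ℤ h′ w ≟ suc j) * 𝟙 (height h′ w ≟ℤ 0ℤ)
                   ≡ ∑[ i ≤ length w ] 𝟙 (𝟙 (h′ ≟ℤ 0ℤ) + visits 0ℤ h′ (take i w) ≟ 1)
                                       * 𝟙 (height h′ (take i w) ≟ℤ 0ℤ) * meets j (drop i w)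
  afterStep +0             = sym (meets-zero-prefix w (λ i → meets j (drop i w)))
  afterStep h′@(+[1+ _ ])  = returns-split j h′ w
  afterStep h′@(-[1+ _ ])  = returns-split j h′ w

-- Since steps change the height by at most 1, avoiding −1 means staying nonnegative.
nonnegPath : ℤ → List Step² → ℕ
nonnegPath h w = 𝟙 (visits -1ℤ h w ≟ 0) * 𝟙 (height h w ≟ℤ 0ℤ)

nonnegBridge : List Step² → ℕ
nonnegBridge = nonnegPath 0ℤ

descent-split : ∀ k w → nonnegPath +[1+ k ] w
                        ≡ ∑[ i ≤ length w ] returns +[1+ k ] 1 (take i w) * nonnegBridge (drop i w)
descent-split′ : ∀ m w → nonnegPath (ℤ.+ m) w
                         ≡ ∑[ i ≤ length w ] 𝟙 (𝟙 (ℤ.+ m ≟ℤ 0ℤ) + visits 0ℤ (ℤ.+ m) (take i w) ≟ 1)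
                                             * 𝟙 (height (ℤ.+ m) (take i w) ≟ℤ 0ℤ) * nonnegBridge (drop i w)

descent-split k []       = refl
descent-split k (EE ∷ w) = descent-split′ (suc k) w
descent-split k (EN ∷ w) = descent-split′ (suc (suc k)) w
descent-split k (NE ∷ w) = descent-split′ k w
descent-split k (NN ∷ w) = descent-split′ (suc k) w

descent-split′ zero    w = sym (meets-zero-prefix w (λ i → nonnegBridge (drop i w)))
descent-split′ (suc k) w = descent-split k w

-- An excursion (meets 1) has the sign of its first step throughout.
flatExcursion positiveExcursion negativeExcursion nonnegExcursion : List Step² → ℕ
flatExcursion w@(EE ∷ _) = meets 1 w
flatExcursion w@(NN ∷ _) = meets 1 w
flatExcursion _          = 0
positiveExcursion w@(EN ∷ _) = meets 1 w
positiveExcursion _          = 0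
negativeExcursion w@(NE ∷ _) = meets 1 w
negativeExcursion _          = 0
nonnegExcursion (NE ∷ _) = 0
nonnegExcursion w        = meets 1 w

excursion-by-sign : ∀ w → meets 1 w ≡ flatExcursion w + positiveExcursion w + negativeExcursion w
excursion-by-sign []       = refl
excursion-by-sign (EE ∷ w) = sym (trans (+-identityʳ _) (+-identityʳ _))
excursion-by-sign (EN ∷ w) = sym (+-identityʳ _)
excursion-by-sign (NE ∷ w) = refl
excursion-by-sign (NN ∷ w) = sym (trans (+-identityʳ _) (+-identityʳ _))

nonnegExcursion-by-sign : ∀ w → nonnegExcursion w ≡ flatExcursion w + positiveExcursion w
nonnegExcursion-by-sign []       = refl
nonnegExcursion-by-sign (EE ∷ w) = sym (+-identityʳ _)
nonnegExcursion-by-sign (EN ∷ w) = refl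
nonnegExcursion-by-sign (NE ∷ w) = refl
nonnegExcursion-by-sign (NN ∷ w) = sym (+-identityʳ _)

nonnegBridge-split : ∀ c w → nonnegBridge (c ∷ w)
                     ≡ ∑[ i ≤ length (c ∷ w) ] nonnegExcursion (take i (c ∷ w)) * nonnegBridge (drop i (c ∷ w))
nonnegBridge-split EE w = sym (meets-zero-prefix w (λ i → nonnegBridge (drop i w)))
nonnegBridge-split EN w = descent-split 0 w
nonnegBridge-split NE w = sym (sum≤-zero (length w) (λ _ → refl))
nonnegBridge-split NN w = sym (meets-zero-prefix w (λ i → nonnegBridge (drop i w)))

positiveExcursion-snoc : ∀ u c → positiveExcursion (EN ∷ u ++ [ c ])
                         ≡ 𝟙 (visits -1ℤ 0ℤ u ≟ 0) * 𝟙 (shift c (sucℤ (height 0ℤ u)) ≟ℤ 0ℤ)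
positiveExcursion-snoc u c = begin
  𝟙 (visits 0ℤ (ℤ.+ 1) (u ++ [ c ]) ≟ 1) * 𝟙 (height (ℤ.+ 1) (u ++ [ c ]) ≟ℤ 0ℤ)
    ≡⟨ cong₂ (λ k h → 𝟙 (k ≟ 1) * 𝟙 (h ≟ℤ 0ℤ))
             (visits-++ 0ℤ (ℤ.+ 1) u [ c ]) (height-++ (ℤ.+ 1) u [ c ]) ⟩
  𝟙 (visits 0ℤ (ℤ.+ 1) u + (𝟙 (last ≟ℤ 0ℤ) + 0) ≟ 1) * 𝟙 (last ≟ℤ 0ℤ)
    ≡⟨ lastVisit (visits 0ℤ (ℤ.+ 1) u) (last ≟ℤ 0ℤ) ⟩
  𝟙 (visits 0ℤ (ℤ.+ 1) u ≟ 0) * 𝟙 (last ≟ℤ 0ℤ)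
    ≡⟨ cong₂ (λ k h → 𝟙 (k ≟ 0) * 𝟙 (shift c h ≟ℤ 0ℤ))
             (visits-sucℤ -1ℤ 0ℤ u) (height-sucℤ 0ℤ u) ⟩
  𝟙 (visits -1ℤ 0ℤ u ≟ 0) * 𝟙 (shift c (sucℤ (height 0ℤ u)) ≟ℤ 0ℤ) ∎
  where
  open ≡-Reasoning
  last : ℤ
  last = shift c (height (ℤ.+ 1) u)
  lastVisit : ∀ k {A : Set} (a? : Dec A) → 𝟙 (k + (𝟙 a? + 0) ≟ 1) * 𝟙 a? ≡ 𝟙 (k ≟ 0) * 𝟙 a?
  lastVisit k (yes _) = cong (λ m → 𝟙 (m ≟ 1) * 1) (+-comm k 1)
  lastVisit k (no _)  = trans (*-zeroʳ (𝟙 (k + 0 ≟ 1))) (sym (*-zeroʳ (𝟙 (k ≟ 0))))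

positiveExcursion-NE : ∀ u → positiveExcursion (EN ∷ u ++ [ NE ]) ≡ nonnegBridge u
positiveExcursion-NE u = trans (positiveExcursion-snoc u NE)
  (cong (λ h → 𝟙 (visits -1ℤ 0ℤ u ≟ 0) * 𝟙 (h ≟ℤ 0ℤ)) (ℤₚ.pred-suc (height 0ℤ u)))

positiveExcursion-¬NE : ∀ u c → c ≢ NE → positiveExcursion (EN ∷ u ++ [ c ]) ≡ 0
positiveExcursion-¬NE u c c≢NE = trans (positiveExcursion-snoc u c)
  (trans (𝟙-guard (visits -1ℤ 0ℤ u ≟ 0) (λ avoids → overshoots c c≢NE (height-nonneg 0 u avoids)))
         (*-zeroʳ (𝟙 (visits -1ℤ 0ℤ u ≟ 0))))
  where
  overshoots : ∀ c → c ≢ NE → (∃ λ m → height 0ℤ u ≡ ℤ.+ m) →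
               𝟙 (shift c (sucℤ (height 0ℤ u)) ≟ℤ 0ℤ) ≡ 0
  overshoots EE _    (m , h≡m) rewrite h≡m = refl
  overshoots EN _    (m , h≡m) rewrite h≡m = refl
  overshoots NE c≢NE _         = ⊥-elim (c≢NE refl)
  overshoots NN _    (m , h≡m) rewrite h≡m = refl

level : Point → ℕ
level (x , y) = x + y

level-step : ∀ p s → level (step p s) ≡ suc (level p)
level-step (x , y) true  = refl
level-step (x , y) false = +-suc x y

level-endFrom : ∀ p a → level (endFrom p a) ≡ level p + length a
level-endFrom p []      = sym (+-identityʳ (level p))
level-endFrom p (s ∷ a) = trans (level-endFrom (step p s) a)
  (trans (cong (_+ length a) (level-step p s)) (sym (+-suc (level p) (length a))))

level-visited : ∀ p a {z} → z ∈ visitedFrom p a → level p < level z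
level-visited p (s ∷ a) (here refl)  = ≤-reflexive (sym (level-step p s))
level-visited p (s ∷ a) (there z∈)   = <-trans (≤-reflexive (sym (level-step p s))) (level-visited (step p s) a z∈)

gap : Point → Point → ℤ
gap (x₁ , _) (x₂ , _) = ℤ.+ x₁ - ℤ.+ x₂

gap-step : ∀ p q c → gap (step p (first c)) (step q (second c)) ≡ shift c (gap p q)
gap-step (x₁ , _) (x₂ , _) EE = lemma (ℤ.+ x₁) (ℤ.+ x₂)
  where
  lemma : ∀ a b → (1ℤ ℤ.+ a) - (1ℤ ℤ.+ b) ≡ a - b
  lemma = ℤ-Solver.solve-∀
gap-step (x₁ , _) (x₂ , _) EN = lemma (ℤ.+ x₁) (ℤ.+ x₂)
  where
  lemma : ∀ a b → (1ℤ ℤ.+ a) - b ≡ 1ℤ ℤ.+ (a - b)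
  lemma = ℤ-Solver.solve-∀
gap-step (x₁ , _) (x₂ , _) NE = lemma (ℤ.+ x₁) (ℤ.+ x₂)
  where
  lemma : ∀ a b → a - (1ℤ ℤ.+ b) ≡ -1ℤ ℤ.+ (a - b)
  lemma = ℤ-Solver.solve-∀
gap-step (x₁ , _) (x₂ , _) NN = refl

height-gap : ∀ p q w → height (gap p q) w ≡ gap (endFrom p (walk₁ w)) (endFrom q (walk₂ w))
height-gap p q []      = refl
height-gap p q (c ∷ w) =
  trans (cong (λ h → height h w) (sym (gap-step p q c))) (height-gap (step p (first c)) (step q (second c)) w)

proj₁-endFrom : ∀ x y a → proj₁ (endFrom (x , y) a) ≡ x + east a
proj₁-endFrom x y []          = sym (+-identityʳ x)
proj₁-endFrom x y (true ∷ a)  = trans (proj₁-endFrom (suc x) y a) (sym (+-suc x (east a)))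
proj₁-endFrom x y (false ∷ a) = proj₁-endFrom x (suc y) a

gap≡0⇒proj₁≡ : ∀ p q → gap p q ≡ 0ℤ → proj₁ p ≡ proj₁ q
gap≡0⇒proj₁≡ (x₁ , _) (x₂ , _) eq = ℤₚ.+-injective (ℤₚ.i-j≡0⇒i≡j (ℤ.+ x₁) (ℤ.+ x₂) eq)

proj₁≡⇒gap≡0 : ∀ p q → proj₁ p ≡ proj₁ q → gap p q ≡ 0ℤ
proj₁≡⇒gap≡0 (x , _) (x , _) refl = ℤₚ.+-inverseʳ (ℤ.+ x)

height-origin : ∀ w → height 0ℤ w ≡ ℤ.+ east (walk₁ w) - ℤ.+ east (walk₂ w)
height-origin w = trans (height-gap (0 , 0) (0 , 0) w)
  (cong₂ (λ x₁ x₂ → ℤ.+ x₁ - ℤ.+ x₂) (proj₁-endFrom 0 0 (walk₁ w)) (proj₁-endFrom 0 0 (walk₂ w)))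

height≡0⇒east≡east : ∀ w → height 0ℤ w ≡ 0ℤ → east (walk₁ w) ≡ east (walk₂ w)
height≡0⇒east≡east w h≡0 = ℤₚ.+-injective (ℤₚ.i-j≡0⇒i≡j _ _ (trans (sym (height-origin w)) h≡0))

𝟙-height≟0 : ∀ w → 𝟙 (height 0ℤ w ≟ℤ 0ℤ) ≡ δ (east (walk₁ w)) (east (walk₂ w))
𝟙-height≟0 w = 𝟙-⇔ (height 0ℤ w ≟ℤ 0ℤ) (east (walk₁ w) ≟ east (walk₂ w)) (height≡0⇒east≡east w)
  (λ e₁≡e₂ → trans (height-origin w)
                   (trans (cong (λ e → ℤ.+ e - ℤ.+ east (walk₂ w)) e₁≡e₂)
                          (ℤₚ.+-inverseʳ (ℤ.+ east (walk₂ w)))))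

≡-from-level-proj₁ : ∀ {p q} → level p ≡ level q → proj₁ p ≡ proj₁ q → p ≡ q
≡-from-level-proj₁ {x , y₁} {x , y₂} same refl = cong (x ,_) (+-cancelˡ-≡ x y₁ y₂ same)

𝟙-≟ᴾ : ∀ p q → level p ≡ level q → 𝟙 (p ≟ᴾ q) ≡ 𝟙 (gap p q ≟ℤ 0ℤ)
𝟙-≟ᴾ p q same = 𝟙-⇔ (p ≟ᴾ q) (gap p q ≟ℤ 0ℤ)
  (proj₁≡⇒gap≡0 p q ∘ cong proj₁) (≡-from-level-proj₁ same ∘ gap≡0⇒proj₁≡ p q)

coincidences : Point → Point → List Step → List Step → ℕ
coincidences p q (s ∷ a) (t ∷ b) = 𝟙 (step p s ≟ᴾ step q t) + coincidences (step p s) (step q t) a b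
coincidences _ _ _       _       = 0

coincidences-visits : ∀ p q w → level p ≡ level q → coincidences p q (walk₁ w) (walk₂ w) ≡ visits 0ℤ (gap p q) w
coincidences-visits p q []      _    = refl
coincidences-visits p q (c ∷ w) same =
  cong₂ _+_ (trans (𝟙-≟ᴾ p′ q′ same′) (cong (λ h → 𝟙 (h ≟ℤ 0ℤ)) (gap-step p q c)))
            (trans (coincidences-visits p′ q′ w same′) (cong (λ h → visits 0ℤ h w) (gap-step p q c)))
  where
  p′ = step p (first c)
  q′ = step q (second c)
  same′ : level p′ ≡ level q′
  same′ = trans (level-step p (first c)) (trans (cong suc same) (sym (level-step q (second c))))

-- Counting pairs of walks by the number of east steps of the first walk

-- Among bridges, a pair ends at (r , n ∸ r) exactly when its first walk has r east steps.
count : (List Step² → ℕ) → ℕ → ℕ → ℕ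
count P n r = ∑₂ n (λ w → P w * δ (east (walk₁ w)) r)

infixl 6 _⊕_
infixl 7 _⊛_

_⊕_ : (f g : ℕ → ℕ → ℕ) → ℕ → ℕ → ℕ
(f ⊕ g) n r = f n r + g n r

_⊛_ : (f g : ℕ → ℕ → ℕ) → ℕ → ℕ → ℕ
(f ⊛ g) n r = ∑[ i ≤ n ] ∑[ a ≤ r ] f i a * g (n ∸ i) (r ∸ a)

⊛-cong : ∀ {f f′ g g′ : ℕ → ℕ → ℕ} → (∀ i a → f i a ≡ f′ i a) → (∀ i a → g i a ≡ g′ i a) →
         ∀ n r → (f ⊛ g) n r ≡ (f′ ⊛ g′) n r
⊛-cong f≡ g≡ n r = sum≤-cong n (λ i _ → sum≤-cong r (λ a _ → cong₂ _*_ (f≡ _ _) (g≡ _ _)))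

⊛-distribʳ-⊕ : ∀ f g h n r → ((f ⊕ g) ⊛ h) n r ≡ (f ⊛ h ⊕ g ⊛ h) n r
⊛-distribʳ-⊕ f g h n r =
  trans (sum≤-cong n (λ i _ → trans (sum≤-cong r (λ a _ → *-distribʳ-+ (h (n ∸ i) (r ∸ a)) (f i a) (g i a)))
                                    (sum≤-+ r _ _)))
        (sum≤-+ n _ _)

⊛-distribˡ-⊕ : ∀ f g h n r → (f ⊛ (g ⊕ h)) n r ≡ (f ⊛ g ⊕ f ⊛ h) n r
⊛-distribˡ-⊕ f g h n r =
  trans (sum≤-cong n (λ i _ → trans (sum≤-cong r (λ a _ →
                                        *-distribˡ-+ (f i a) (g (n ∸ i) (r ∸ a)) (h (n ∸ i) (r ∸ a))))
                                    (sum≤-+ r _ _)))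
        (sum≤-+ n _ _)

⊛-comm : ∀ f g n r → (f ⊛ g) n r ≡ (g ⊛ f) n r
⊛-comm f g n r =
  trans (sum≤-reverse n _)
    (sum≤-cong n (λ i i≤n → trans (sum≤-reverse r _)
      (sum≤-cong r (λ a a≤r → trans (*-comm (f (n ∸ i) (r ∸ a)) _)
         (cong₂ (λ m b → g m b * f (n ∸ i) (r ∸ a)) (m∸[m∸n]≡n i≤n) (m∸[m∸n]≡n a≤r))))))

count-⊕ : ∀ {P Q R : List Step² → ℕ} → (∀ w → P w ≡ Q w + R w) →
          ∀ n r → count P n r ≡ (count Q ⊕ count R) n r
count-⊕ {P} {Q} {R} P≡Q+R n r =
  trans (∑₂-cong n (λ w _ → trans (cong (_* δ (east (walk₁ w)) r) (P≡Q+R w)) (*-distribʳ-+ _ (Q w) (R w))))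
        (∑₂-+ n _ _)

count-split : ∀ {P A B : List Step² → ℕ} n r →
              (∀ w → length w ≡ n → P w ≡ ∑[ i ≤ length w ] A (take i w) * B (drop i w)) →
              count P n r ≡ (count A ⊛ count B) n r
count-split {P} {A} {B} n r split = begin
  ∑₂ n (λ w → P w * δ (e₁ w) r)
    ≡⟨ ∑₂-cong n (λ w len → splitAll w len) ⟩
  ∑₂ n (λ w → ∑[ i ≤ n ] ∑[ a ≤ r ] A′ a (take i w) * B′ a (drop i w))
    ≡⟨ ∑₂-sum≤ n n _ ⟩
  ∑[ i ≤ n ] ∑₂ n (λ w → ∑[ a ≤ r ] A′ a (take i w) * B′ a (drop i w))
    ≡⟨ sum≤-cong n (λ i i≤n → trans (∑₂-sum≤ n r _)
                                    (sum≤-cong r (λ a _ → ∑₂-split≤ i≤n (A′ a) (B′ a)))) ⟩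
  (count A ⊛ count B) n r ∎
  where
  open ≡-Reasoning
  e₁ : List Step² → ℕ
  e₁ = east ∘ walk₁
  A′ B′ : ℕ → List Step² → ℕ
  A′ a u = A u * δ (e₁ u) a
  B′ a v = B v * δ (e₁ v) (r ∸ a)
  splitAt : ∀ i w →
            A (take i w) * B (drop i w) * δ (e₁ w) r ≡ ∑[ a ≤ r ] A′ a (take i w) * B′ a (drop i w)
  splitAt i w = begin
    A u * B v * δ (e₁ w) r
      ≡⟨ cong (λ e → A u * B v * δ e r) (sym (east-take-drop i w)) ⟩
    A u * B v * δ (e₁ u + e₁ v) r
      ≡⟨ cong (A u * B v *_) (δ-+ (e₁ u) (e₁ v) r) ⟩
    A u * B v * (∑[ a ≤ r ] δ (e₁ u) a * δ (e₁ v) (r ∸ a))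
      ≡⟨ sym (sum≤-*ˡ r (A u * B v) _) ⟩
    ∑[ a ≤ r ] A u * B v * (δ (e₁ u) a * δ (e₁ v) (r ∸ a))
      ≡⟨ sum≤-cong r (λ a _ → interchange (A u) (B v) (δ (e₁ u) a) (δ (e₁ v) (r ∸ a))) ⟩
    ∑[ a ≤ r ] A′ a u * B′ a v ∎
    where
    u v : List Step²
    u = take i w
    v = drop i w
    interchange : ∀ a b c d → a * b * (c * d) ≡ a * c * (b * d)
    interchange = solve-∀
  splitAll : ∀ w → length w ≡ n →
             P w * δ (e₁ w) r ≡ ∑[ i ≤ n ] ∑[ a ≤ r ] A′ a (take i w) * B′ a (drop i w)
  splitAll w len = begin
    P w * δ (e₁ w) r
      ≡⟨ cong (_* δ (e₁ w) r) (split w len) ⟩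
    (∑[ i ≤ length w ] A (take i w) * B (drop i w)) * δ (e₁ w) r
      ≡⟨ sym (sum≤-*ʳ (length w) (δ (e₁ w) r) _) ⟩
    ∑[ i ≤ length w ] A (take i w) * B (drop i w) * δ (e₁ w) r
      ≡⟨ cong (λ m → ∑[ i ≤ m ] A (take i w) * B (drop i w) * δ (e₁ w) r) len ⟩
    ∑[ i ≤ n ] A (take i w) * B (drop i w) * δ (e₁ w) r
      ≡⟨ sum≤-cong n (λ i _ → splitAt i w) ⟩
    ∑[ i ≤ n ] ∑[ a ≤ r ] A′ a (take i w) * B′ a (drop i w) ∎

count-meets-suc : ∀ j n r → count (meets (suc j)) n r ≡ (count (meets 1) ⊛ count (meets j)) n r
count-meets-suc j n r = count-split {A = meets 1} {B = meets j} n r (λ w _ → returns-split j 0ℤ w)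

count-nonnegBridge : ∀ m r →
                     count nonnegBridge (suc m) r ≡ (count nonnegExcursion ⊛ count nonnegBridge) (suc m) r
count-nonnegBridge m r = count-split {nonnegBridge} {nonnegExcursion} {nonnegBridge} (suc m) r
                                     (λ { (c ∷ w) _ → nonnegBridge-split c w })

count-negative≡positive : ∀ n r → count negativeExcursion n r ≡ count positiveExcursion n r
count-negative≡positive n r = begin
  count negativeExcursion n r
    ≡⟨ sym (∑₂-swap n (λ w → negativeExcursion w * δ (east (walk₁ w)) r)) ⟩
  ∑₂ n (λ w → negativeExcursion (map swap w) * δ (east (walk₁ (map swap w))) r)
    ≡⟨ ∑₂-cong n (λ w _ → cong₂ (λ k e → k * δ e r) (negative-swap w) (cong east (walk₁-swap w))) ⟩
  ∑₂ n (λ w → positiveExcursion w * δ (east (walk₂ w)) r)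
    ≡⟨ ∑₂-cong n (λ w _ → positive-balanced w) ⟩
  count positiveExcursion n r ∎
  where
  open ≡-Reasoning
  negative-swap : ∀ w → negativeExcursion (map swap w) ≡ positiveExcursion w
  negative-swap []       = refl
  negative-swap (EE ∷ w) = refl
  negative-swap (EN ∷ w) = meets-swap 1 (EN ∷ w)
  negative-swap (NE ∷ w) = refl
  negative-swap (NN ∷ w) = refl
  walk₁-swap : ∀ w → walk₁ (map swap w) ≡ walk₂ w
  walk₁-swap []       = refl
  walk₁-swap (EE ∷ w) = cong (true ∷_) (walk₁-swap w)
  walk₁-swap (EN ∷ w) = cong (false ∷_) (walk₁-swap w)
  walk₁-swap (NE ∷ w) = cong (true ∷_) (walk₁-swap w)
  walk₁-swap (NN ∷ w) = cong (false ∷_) (walk₁-swap w)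
  positive-balanced : ∀ w →
                      positiveExcursion w * δ (east (walk₂ w)) r ≡ positiveExcursion w * δ (east (walk₁ w)) r
  positive-balanced []         = refl
  positive-balanced (EE ∷ _)   = refl
  positive-balanced w@(EN ∷ _) =
    trans (*-assoc (𝟙 (visits 0ℤ 0ℤ w ≟ 1)) _ _)
      (trans (cong (𝟙 (visits 0ℤ 0ℤ w ≟ 1) *_)
                   (𝟙-guard (height 0ℤ w ≟ℤ 0ℤ)
                            (λ h≡0 → cong (λ e → δ e r) (sym (height≡0⇒east≡east w h≡0)))))
             (sym (*-assoc (𝟙 (visits 0ℤ 0ℤ w ≟ 1)) _ _)))
  positive-balanced (NE ∷ _)   = refl
  positive-balanced (NN ∷ _)   = refl

count-positive-east0 : ∀ n → count positiveExcursion n 0 ≡ 0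
count-positive-east0 n = ∑₂-zero n startsEast
  where
  startsEast : ∀ w → positiveExcursion w * δ (east (walk₁ w)) 0 ≡ 0
  startsEast []         = refl
  startsEast (EE ∷ _)   = refl
  startsEast w@(EN ∷ _) = *-zeroʳ (positiveExcursion w)
  startsEast (NE ∷ _)   = refl
  startsEast (NN ∷ _)   = refl

-- A positive excursion of length n + 2 is EN, then a nonnegative bridge of length n, then NE.
count-positive-shift : ∀ n r → count positiveExcursion (suc (suc n)) (suc r) ≡ count nonnegBridge n r
count-positive-shift n r = begin
  count positiveExcursion (suc (suc n)) (suc r)
    ≡⟨ cong₂ (λ x y → x + ∑₂ (suc n) g + y) (∑₂-zero (suc n) (λ _ → refl))
             (cong₂ _+_ (∑₂-zero (suc n) (λ _ → refl)) (∑₂-zero (suc n) (λ _ → refl))) ⟩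
  ∑₂ (suc n) g + 0                              ≡⟨ +-identityʳ _ ⟩
  ∑₂ (suc n) g                                  ≡⟨ cong (λ m → ∑₂ m g) (+-comm 1 n) ⟩
  ∑₂ (n + 1) g                                  ≡⟨ ∑₂-++ n 1 g ⟩
  ∑₂ n (λ u → ∑₂ 1 (λ v → g (u ++ v)))          ≡⟨ ∑₂-cong n (λ u _ → lastStep u) ⟩
  count nonnegBridge n r                        ∎
  where
  open ≡-Reasoning
  g : List Step² → ℕ
  g w = positiveExcursion (EN ∷ w) * δ (east (walk₁ w)) r
  lastStep : ∀ u → ∑₂ 1 (λ v → g (u ++ v)) ≡ nonnegBridge u * δ (east (walk₁ u)) r
  lastStep u
    rewrite positiveExcursion-¬NE u EE (λ ()) | positiveExcursion-¬NE u EN (λ ())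
          | positiveExcursion-¬NE u NN (λ ()) | positiveExcursion-NE u
          | map-++ first u [ NE ] | east-++ (walk₁ u) [ false ] | +-identityʳ (east (walk₁ u))
    = +-identityʳ _

count-flat-long : ∀ n r → count flatExcursion (suc (suc n)) r ≡ 0
count-flat-long n r = trans (∑₂-cong (suc (suc n)) returnsEarly) (∑₂-zero (suc (suc n)) (λ _ → refl))
  where
  returnsEarly : ∀ w → length w ≡ suc (suc n) → flatExcursion w * δ (east (walk₁ w)) r ≡ 0
  returnsEarly (EE ∷ c ∷ w) _ = cong (_* δ (east (walk₁ (EE ∷ c ∷ w))) r) (ends-at-visited 0ℤ (shift c 0ℤ) w)
  returnsEarly (EN ∷ _ ∷ _) _ = refl
  returnsEarly (NE ∷ _ ∷ _) _ = refl
  returnsEarly (NN ∷ c ∷ w) _ = cong (_* δ (east (walk₁ (NN ∷ c ∷ w))) r) (ends-at-visited 0ℤ (shift c 0ℤ) w)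

⊛-positive-east0 : ∀ f n → (count positiveExcursion ⊛ f) n 0 ≡ 0
⊛-positive-east0 f n = sum≤-zero n (λ i → cong (_* f (n ∸ i) 0) (count-positive-east0 i))

⊛-positive-shift : ∀ f n r → (count positiveExcursion ⊛ f) (suc (suc n)) (suc r) ≡ (count nonnegBridge ⊛ f) n r
⊛-positive-shift f n r =
  cong₂ _+_ (sum≤-zero (suc r) (λ _ → refl))
    (cong₂ _+_ (sum≤-zero (suc r) (λ _ → refl))
      (sum≤-cong n (λ i _ →
        cong₂ _+_ (cong (_* f (n ∸ i) (suc r)) (count-positive-east0 (suc (suc i))))
                  (sum≤-cong r (λ a _ → cong (_* f (n ∸ i) (r ∸ a)) (count-positive-shift i a))))))

positive⊛nonnegExcursion : ∀ m r → (count positiveExcursion ⊛ count nonnegExcursion) (3 + m) r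
                                   ≡ count positiveExcursion (3 + m) r
positive⊛nonnegExcursion m zero =
  trans (⊛-positive-east0 (count nonnegExcursion) (3 + m)) (sym (count-positive-east0 (3 + m)))
positive⊛nonnegExcursion m (suc r) = begin
  (count positiveExcursion ⊛ count nonnegExcursion) (3 + m) (suc r)
    ≡⟨ ⊛-positive-shift (count nonnegExcursion) (suc m) r ⟩
  (count nonnegBridge ⊛ count nonnegExcursion) (suc m) r
    ≡⟨ ⊛-comm (count nonnegBridge) (count nonnegExcursion) (suc m) r ⟩
  (count nonnegExcursion ⊛ count nonnegBridge) (suc m) r
    ≡⟨ sym (count-nonnegBridge m r) ⟩
  count nonnegBridge (suc m) r
    ≡⟨ sym (count-positive-shift (suc m) r) ⟩
  count positiveExcursion (3 + m) (suc r) ∎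
  where open ≡-Reasoning

flat⊛flat : ∀ m r → (count flatExcursion ⊛ count flatExcursion) (3 + m) r ≡ 0
flat⊛flat m r = sum≤-zero (3 + m) (λ i → sum≤-zero r (λ a → term i a))
  where
  term : ∀ i a → count flatExcursion i a * count flatExcursion (3 + m ∸ i) (r ∸ a) ≡ 0
  term zero                a = refl
  term (suc zero)          a = trans (cong (count flatExcursion 1 a *_) (count-flat-long m (r ∸ a)))
                                     (*-zeroʳ (count flatExcursion 1 a))
  term (suc (suc i))       a = cong (_* count flatExcursion (3 + m ∸ suc (suc i)) (r ∸ a)) (count-flat-long i a)

count-meets-2≡2*count-meets-1 : ∀ m r → count (meets 2) (3 + m) r ≡ 2 * count (meets 1) (3 + m) r
count-meets-2≡2*count-meets-1 m r = begin
  count (meets 2) n r                              ≡⟨ count-meets-suc 1 n r ⟩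
  (count (meets 1) ⊛ count (meets 1)) n r          ≡⟨ ⊛-cong excursions excursions n r ⟩
  (Y ⊛ Y) n r                                      ≡⟨ ⊛-distribʳ-⊕ (F ⊕ P) P Y n r ⟩
  ((F ⊕ P) ⊛ Y) n r + (P ⊛ Y) n r                  ≡⟨ cong (_+ (P ⊛ Y) n r) (⊛-distribʳ-⊕ F P Y n r) ⟩
  (F ⊛ Y) n r + (P ⊛ Y) n r + (P ⊛ Y) n r          ≡⟨ cong₂ (λ x y → x + y + y) (row F) (row P) ⟩
  ((F ⊛ F) n r + (F ⊛ P) n r + (F ⊛ P) n r) + (a + b + b) + (a + b + b)
      ≡⟨ cong₂ (λ x y → (x + y + y) + (a + b + b) + (a + b + b)) (flat⊛flat m r) (⊛-comm F P n r) ⟩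
  (0 + a + a) + (a + b + b) + (a + b + b)          ≡⟨ regroup a b ⟩
  2 * (0 + (a + b) + (a + b))
      ≡⟨ cong₂ (λ x y → 2 * (x + y + y)) (sym (count-flat-long (suc m) r)) a+b≡P ⟩
  2 * (F n r + P n r + P n r)                      ≡⟨ cong (2 *_) (sym (excursions n r)) ⟩
  2 * count (meets 1) n r                          ∎
  where
  open ≡-Reasoning
  n : ℕ
  n = 3 + m
  F P Y : ℕ → ℕ → ℕ
  F = count flatExcursion
  P = count positiveExcursion
  Y = F ⊕ P ⊕ P
  excursions : ∀ i a → count (meets 1) i a ≡ Y i a
  excursions i a =
    trans (count-⊕ {Q = λ w → flatExcursion w + positiveExcursion w} excursion-by-sign i a)
          (cong₂ _+_ (count-⊕ {Q = flatExcursion} (λ _ → refl) i a) (count-negative≡positive i a))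
  a b : ℕ
  a = (P ⊛ F) n r
  b = (P ⊛ P) n r
  row : ∀ f → (f ⊛ Y) n r ≡ (f ⊛ F) n r + (f ⊛ P) n r + (f ⊛ P) n r
  row f = trans (⊛-distribˡ-⊕ f (F ⊕ P) P n r) (cong (_+ (f ⊛ P) n r) (⊛-distribˡ-⊕ f F P n r))
  a+b≡P : a + b ≡ P n r
  a+b≡P = trans (sym (⊛-distribˡ-⊕ P F P n r))
                (trans (⊛-cong {P} (λ _ _ → refl)
                               (λ i a → sym (count-⊕ {Q = flatExcursion} nonnegExcursion-by-sign i a)) n r)
                       (positive⊛nonnegExcursion m r))
  regroup : ∀ a b → (0 + a + a) + (a + b + b) + (a + b + b) ≡ 2 * (0 + (a + b) + (a + b))
  regroup = solve-∀

-- From lists of walks to sums over words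

length-filter-∷ : ∀ {A : Set} {P : Pred A 0ℓ} (P? : Decidable P) x xs →
                  length (filter P? (x ∷ xs)) ≡ 𝟙 (P? x) + length (filter P? xs)
length-filter-∷ P? x xs with does (P? x)
... | true  = refl
... | false = refl

length-filter≡sum : ∀ {A : Set} {P : Pred A 0ℓ} (P? : Decidable P) xs →
                    length (filter P? xs) ≡ sum (map (𝟙 ∘ P?) xs)
length-filter≡sum P? []       = refl
length-filter≡sum P? (x ∷ xs) = trans (length-filter-∷ P? x xs) (cong (𝟙 (P? x) +_) (length-filter≡sum P? xs))

sum-filter : ∀ {A : Set} {P : Pred A 0ℓ} (P? : Decidable P) (g : A → ℕ) xs →
             sum (map g (filter P? xs)) ≡ sum (map (λ x → 𝟙 (P? x) * g x) xs)
sum-filter P? g []       = refl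
sum-filter P? g (x ∷ xs) with does (P? x)
... | true  = cong₂ _+_ (sym (+-identityʳ (g x))) (sum-filter P? g xs)
... | false = sum-filter P? g xs

sum-cartesianProduct : ∀ {A B : Set} (g : A × B → ℕ) xs (ys : List B) →
  sum (map g (cartesianProduct xs ys)) ≡ sum (map (λ x → sum (map (λ y → g (x , y)) ys)) xs)
sum-cartesianProduct g []       ys = refl
sum-cartesianProduct g (x ∷ xs) ys = begin
  sum (map g (map (x ,_) ys ++ cartesianProduct xs ys))
    ≡⟨ cong sum (map-++ g (map (x ,_) ys) (cartesianProduct xs ys)) ⟩
  sum (map g (map (x ,_) ys) ++ map g (cartesianProduct xs ys))
    ≡⟨ sum-++ (map g (map (x ,_) ys)) _ ⟩
  sum (map g (map (x ,_) ys)) + sum (map g (cartesianProduct xs ys))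
    ≡⟨ cong₂ _+_ (cong sum (sym (map-∘ ys))) (sum-cartesianProduct g xs ys) ⟩
  sum (map (λ y → g (x , y)) ys) + sum (map (λ x → sum (map (λ y → g (x , y)) ys)) xs) ∎
  where open ≡-Reasoning

∑₁ : ℕ → (List Step → ℕ) → ℕ
∑₁ zero    f = f []
∑₁ (suc n) f = ∑₁ n (f ∘ (true ∷_)) + ∑₁ n (f ∘ (false ∷_))

sum-words : ∀ n (g : List Step → ℕ) → sum (map g (words n)) ≡ ∑₁ n g
sum-words zero    g = +-identityʳ (g [])
sum-words (suc n) g = begin
  sum (map g (map (true ∷_) (words n) ++ map (false ∷_) (words n)))
    ≡⟨ cong sum (map-++ g (map (true ∷_) (words n)) _) ⟩
  sum (map g (map (true ∷_) (words n)) ++ map g (map (false ∷_) (words n)))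
    ≡⟨ sum-++ (map g (map (true ∷_) (words n))) _ ⟩
  sum (map g (map (true ∷_) (words n))) + sum (map g (map (false ∷_) (words n)))
    ≡⟨ cong₂ _+_ (trans (cong sum (sym (map-∘ (words n)))) (sum-words n _))
                 (trans (cong sum (sym (map-∘ (words n)))) (sum-words n _)) ⟩
  ∑₁ (suc n) g ∎
  where open ≡-Reasoning

∑₁-+ : ∀ n (f g : List Step → ℕ) → ∑₁ n (λ a → f a + g a) ≡ ∑₁ n f + ∑₁ n g
∑₁-+ zero    f g = refl
∑₁-+ (suc n) f g =
  trans (cong₂ _+_ (∑₁-+ n (f ∘ (true ∷_)) (g ∘ (true ∷_))) (∑₁-+ n (f ∘ (false ∷_)) (g ∘ (false ∷_))))
                         (+-interchange (∑₁ n (f ∘ (true ∷_))) _ _ _)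
  where
  +-interchange : ∀ a b c d → (a + b) + (c + d) ≡ (a + c) + (b + d)
  +-interchange = solve-∀

∑₁-*ˡ : ∀ n k (f : List Step → ℕ) → ∑₁ n (λ a → k * f a) ≡ k * ∑₁ n f
∑₁-*ˡ zero    k f = refl
∑₁-*ˡ (suc n) k f = trans (cong₂ _+_ (∑₁-*ˡ n k (f ∘ (true ∷_))) (∑₁-*ˡ n k (f ∘ (false ∷_))))
                          (sym (*-distribˡ-+ k _ _))

∑₁-cong : ∀ n {f g : List Step → ℕ} → (∀ a → f a ≡ g a) → ∑₁ n f ≡ ∑₁ n g
∑₁-cong zero    f≡g = f≡g []
∑₁-cong (suc n) f≡g = cong₂ _+_ (∑₁-cong n (f≡g ∘ (true ∷_))) (∑₁-cong n (f≡g ∘ (false ∷_)))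

∑₁-∑₁ : ∀ n (G : List Step → List Step → ℕ) →
        ∑₁ n (λ a → ∑₁ n (G a)) ≡ ∑₂ n (λ w → G (walk₁ w) (walk₂ w))
∑₁-∑₁ zero    G = refl
∑₁-∑₁ (suc n) G = cong₂ _+_ (pairWith true) (pairWith false)
  where
  pairWith : ∀ s → ∑₁ n (λ a → ∑₁ (suc n) (G (s ∷ a)))
                   ≡ ∑₂ n (λ w → G (s ∷ walk₁ w) (true ∷ walk₂ w))
                     + ∑₂ n (λ w → G (s ∷ walk₁ w) (false ∷ walk₂ w))
  pairWith s =
    trans (∑₁-+ n (λ a → ∑₁ n (G (s ∷ a) ∘ (true ∷_))) (λ a → ∑₁ n (G (s ∷ a) ∘ (false ∷_))))
          (cong₂ _+_ (∑₁-∑₁ n (λ a b → G (s ∷ a) (true ∷ b))) (∑₁-∑₁ n (λ a b → G (s ∷ a) (false ∷ b))))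

endFrom-origin : ∀ n r a → length a ≡ n → east a ≡ r → endFrom (0 , 0) a ≡ (r , n ∸ r)
endFrom-origin n r a len refl = ≡-from-level-proj₁
  (trans (level-endFrom (0 , 0) a) (trans len (sym (m+[n∸m]≡n (subst (east a ≤_) len (east≤length a))))))
  (proj₁-endFrom 0 0 a)

𝟙-ends-at : ∀ n r a → length a ≡ n → 𝟙 (endFrom (0 , 0) a ≟ᴾ (r , n ∸ r)) ≡ δ (east a) r
𝟙-ends-at n r a len = 𝟙-⇔ (endFrom (0 , 0) a ≟ᴾ (r , n ∸ r)) (east a ≟ r)
  (λ end≡ → trans (sym (proj₁-endFrom 0 0 a)) (cong proj₁ end≡)) (endFrom-origin n r a len)

first-vertex≢end : ∀ p s s′ a → step p s ≢ endFrom p (s ∷ s′ ∷ a)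
first-vertex≢end p s s′ a eq =
  m+1+n≢m (level (step p s)) (trans (sym (level-endFrom (step p s) (s′ ∷ a))) (cong level (sym eq)))

_∈ᴾ?_ : (z : Point) (L : List Point) → Dec (z ∈ L)
z ∈ᴾ? L = DecMembership._∈?_ _≟ᴾ_ z L

visited-at-next-level : ∀ pre q t b {z} → (∀ x → x ∈ pre → level x ≤ level q) → level z ≡ suc (level q) →
                        z ∈ pre ++ visitedFrom q (t ∷ b) → z ≡ step q t
visited-at-next-level pre q t b below z-level z∈ with ∈-++⁻ pre z∈
... | inj₁ z∈pre      = ⊥-elim (1+n≰n (subst (_≤ level q) z-level (below _ z∈pre)))
... | inj₂ (here z≡)  = z≡
... | inj₂ (there z∈) = ⊥-elim (<-irrefl (trans (level-step q t) (sym z-level)) (level-visited (step q t) b z∈))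

-- Both walks are at level i after i steps, so a vertex of the first walk lies on the second
-- exactly when the walks are at the same point at that time.
intersections-along : ∀ e pre p q s t a b → length a ≡ length b → level p ≡ level q →
  (∀ x → x ∈ pre → level x ≤ level q) → endFrom p (s ∷ a) ≡ e → endFrom q (t ∷ b) ≡ e →
  suc (length (filter (λ z → z ∈ᴾ? (pre ++ visitedFrom q (t ∷ b)))
                      (filter (λ z → ¬? (z ≟ᴾ e)) (visitedFrom p (s ∷ a)))))
    ≡ coincidences p q (s ∷ a) (t ∷ b)
intersections-along e pre p q s t [] [] _ _ _ end₁ end₂ =
  trans (cong (λ L → suc (length (filter (λ z → z ∈ᴾ? (pre ++ step q t ∷ [])) L)))
              (filter-reject (λ z → ¬? (z ≟ᴾ e)) (λ p₁≢e → p₁≢e end₁)))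
        (sym (cong (_+ 0) (𝟙-yes (step p s ≟ᴾ step q t) (trans end₁ (sym end₂)))))
intersections-along e pre p q s t (s′ ∷ a) (t′ ∷ b) len same below end₁ end₂ = begin
  suc (length (filter onSecond (filter notEnd (p₁ ∷ rest))))
    ≡⟨ cong (λ L → suc (length (filter onSecond L))) (filter-accept notEnd p₁≢e) ⟩
  suc (length (filter onSecond (p₁ ∷ filter notEnd rest)))
    ≡⟨ cong suc (length-filter-∷ onSecond p₁ _) ⟩
  suc (𝟙 (onSecond p₁) + length (filter onSecond (filter notEnd rest)))
    ≡⟨ sym (+-suc _ _) ⟩
  𝟙 (onSecond p₁) + suc (length (filter onSecond (filter notEnd rest)))
    ≡⟨ cong₂ _+_ firstVertex laterVertices ⟩
  𝟙 (p₁ ≟ᴾ q₁) + coincidences p₁ q₁ (s′ ∷ a) (t′ ∷ b) ∎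
  where
  open ≡-Reasoning
  p₁ q₁ : Point
  p₁ = step p s
  q₁ = step q t
  rest : List Point
  rest = visitedFrom p₁ (s′ ∷ a)
  onSecond notEnd : (z : Point) → Dec _
  onSecond z = z ∈ᴾ? (pre ++ visitedFrom q (t ∷ t′ ∷ b))
  notEnd z = ¬? (z ≟ᴾ e)
  p-level : suc (level q) ≡ level p₁
  p-level = trans (cong suc (sym same)) (sym (level-step p s))
  same′ : level p₁ ≡ level q₁
  same′ = trans (sym p-level) (sym (level-step q t))
  p₁≢e : ¬ p₁ ≡ e
  p₁≢e p₁≡e = first-vertex≢end p s s′ a (trans p₁≡e (sym end₁))
  firstVertex : 𝟙 (onSecond p₁) ≡ 𝟙 (p₁ ≟ᴾ q₁)
  firstVertex = 𝟙-⇔ (onSecond p₁) (p₁ ≟ᴾ q₁) (visited-at-next-level pre q t (t′ ∷ b) below (sym p-level))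
                    (λ p₁≡q₁ → ∈-++⁺ʳ pre (here p₁≡q₁))
  below′ : ∀ x → x ∈ pre ++ [ q₁ ] → level x ≤ level q₁
  below′ x x∈ with ∈-++⁻ pre x∈
  ... | inj₁ x∈pre       =
    ≤-trans (below x x∈pre) (≤-trans (n≤1+n (level q)) (≤-reflexive (sym (level-step q t))))
  ... | inj₂ (here refl) = ≤-refl
  laterVertices : suc (length (filter onSecond (filter notEnd rest))) ≡ coincidences p₁ q₁ (s′ ∷ a) (t′ ∷ b)
  laterVertices =
    trans (cong (λ L → suc (length (filter (λ z → z ∈ᴾ? L) (filter notEnd rest))))
                (sym (++-assoc pre [ q₁ ] (visitedFrom q₁ (t′ ∷ b)))))
          (intersections-along e (pre ++ [ q₁ ]) p₁ q₁ s′ t′ a b (suc-injective len) same′ below′ end₁ end₂)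

intersections-coincidences : ∀ e s t a b → length a ≡ length b →
  endFrom (0 , 0) (s ∷ a) ≡ e → endFrom (0 , 0) (t ∷ b) ≡ e →
  suc (intersections e (s ∷ a) (t ∷ b)) ≡ coincidences (0 , 0) (0 , 0) (s ∷ a) (t ∷ b)
intersections-coincidences e s t a b len end₁ end₂ =
  trans (cong (λ L → suc (length (filter (λ z → z ∈ᴾ? vertices (t ∷ b)) (filter (λ z → ¬? (z ≟ᴾ e)) L))))
              (trans (filter-reject notOrigin {(0 , 0)} {visitedFrom (0 , 0) (s ∷ a)} (λ ≢0 → ≢0 refl))
                     (filter-all notOrigin {visitedFrom (0 , 0) (s ∷ a)} (tabulate off-origin))))
        (intersections-along e [ (0 , 0) ] (0 , 0) (0 , 0) s t a b len refl (λ { _ (here refl) → z≤n }) end₁ end₂)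
  where
  notOrigin : (z : Point) → Dec _
  notOrigin z = ¬? (z ≟ᴾ (0 , 0))
  off-origin : ∀ {z} → z ∈ visitedFrom (0 , 0) (s ∷ a) → ¬ z ≡ (0 , 0)
  off-origin z∈ refl = <-irrefl refl (level-visited (0 , 0) (s ∷ a) z∈)

δ-both-ends : ∀ x y r I V k → (x ≡ r → y ≡ r → suc I ≡ V) →
              δ x r * (δ y r * δ I k) ≡ δ V (suc k) * δ x y * δ x r
δ-both-ends x y r I V k hyp with x ≟ r
... | no x≢r rewrite δ-≢ x≢r = sym (*-zeroʳ (δ V (suc k) * δ x y))
... | yes refl with y ≟ x
...   | no y≢x   rewrite δ-≢ y≢x | δ-≢ (y≢x ∘ sym) | δ-refl x =
  sym (trans (*-identityʳ _) (*-zeroʳ (δ V (suc k))))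
...   | yes refl rewrite δ-refl x | sym (hyp refl refl) = lemma (δ I k)
  where
  lemma : ∀ d → 1 * (1 * d) ≡ d * 1 * 1
  lemma = solve-∀

N≡count-meets : ∀ k n r → N k (suc n) r ≡ count (meets (suc k)) (suc n) r
N≡count-meets k n r = begin
  N k (suc n) r
    ≡⟨ length-filter≡sum _ (cartesianProduct W W) ⟩
  sum (map (λ ab → χ (proj₁ ab) (proj₂ ab)) (cartesianProduct W W))
    ≡⟨ sum-cartesianProduct (λ ab → χ (proj₁ ab) (proj₂ ab)) W W ⟩
  sum (map (λ a → sum (map (χ a) W)) W)
    ≡⟨ sum-filter E? (λ a → sum (map (χ a) W)) (words (suc n)) ⟩
  sum (map (λ a → 𝟙 (E? a) * sum (map (χ a) W)) (words (suc n)))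
    ≡⟨ sum-words (suc n) _ ⟩
  ∑₁ (suc n) (λ a → 𝟙 (E? a) * sum (map (χ a) W))
    ≡⟨ ∑₁-cong (suc n) (λ a → cong (𝟙 (E? a) *_)
                                   (trans (sum-filter E? (χ a) (words (suc n))) (sum-words (suc n) _))) ⟩
  ∑₁ (suc n) (λ a → 𝟙 (E? a) * ∑₁ (suc n) (λ b → 𝟙 (E? b) * χ a b))
    ≡⟨ ∑₁-cong (suc n) (λ a → sym (∑₁-*ˡ (suc n) (𝟙 (E? a)) (λ b → 𝟙 (E? b) * χ a b))) ⟩
  ∑₁ (suc n) (λ a → ∑₁ (suc n) (λ b → 𝟙 (E? a) * (𝟙 (E? b) * χ a b)))
    ≡⟨ ∑₁-∑₁ (suc n) (λ a b → 𝟙 (E? a) * (𝟙 (E? b) * χ a b)) ⟩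
  ∑₂ (suc n) (λ w → 𝟙 (E? (walk₁ w)) * (𝟙 (E? (walk₂ w)) * χ (walk₁ w) (walk₂ w)))
    ≡⟨ ∑₂-cong (suc n) pairOfWalks ⟩
  count (meets (suc k)) (suc n) r ∎
  where
  open ≡-Reasoning
  e : Point
  e = (r , suc n ∸ r)
  W : List (List Step)
  W = walks (suc n) r
  E? : (a : List Step) → Dec (endFrom (0 , 0) a ≡ e)
  E? a = endFrom (0 , 0) a ≟ᴾ e
  χ : List Step → List Step → ℕ
  χ a b = δ (intersections e a b) k
  pairOfWalks : ∀ w → length w ≡ suc n →
                𝟙 (E? (walk₁ w)) * (𝟙 (E? (walk₂ w)) * χ (walk₁ w) (walk₂ w))
                  ≡ meets (suc k) w * δ (east (walk₁ w)) r
  pairOfWalks (c ∷ w) len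
    rewrite 𝟙-ends-at (suc n) r (walk₁ (c ∷ w)) (trans (length-map first (c ∷ w)) len)
          | 𝟙-ends-at (suc n) r (walk₂ (c ∷ w)) (trans (length-map second (c ∷ w)) len)
          | 𝟙-height≟0 (c ∷ w)
    = δ-both-ends (east (walk₁ (c ∷ w))) (east (walk₂ (c ∷ w))) r _ (visits 0ℤ 0ℤ (c ∷ w)) k meetsAtEnd
    where
    lenᵢ : ∀ f → length (map f w) ≡ n
    lenᵢ f = trans (length-map f w) (suc-injective len)
    meetsAtEnd : east (walk₁ (c ∷ w)) ≡ r → east (walk₂ (c ∷ w)) ≡ r →
                 suc (intersections e (walk₁ (c ∷ w)) (walk₂ (c ∷ w))) ≡ visits 0ℤ 0ℤ (c ∷ w)
    meetsAtEnd e₁≡r e₂≡r =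
      trans (intersections-coincidences e (first c) (second c) (walk₁ w) (walk₂ w)
                                          (trans (lenᵢ first) (sym (lenᵢ second)))
               (endFrom-origin (suc n) r (walk₁ (c ∷ w)) (cong suc (lenᵢ first)) e₁≡r)
               (endFrom-origin (suc n) r (walk₂ (c ∷ w)) (cong suc (lenᵢ second)) e₂≡r))
            (coincidences-visits (0 , 0) (0 , 0) (c ∷ w) refl)

mainTheorem4 : (n r : ℕ) → 3 ≤ n → r ≤ n → N 1 n r ≡ 2 * N 0 n r
mainTheorem4 (suc (suc (suc m))) r _ _ = begin
  N 1 (3 + m) r                    ≡⟨ N≡count-meets 1 (2 + m) r ⟩
  count (meets 2) (3 + m) r        ≡⟨ count-meets-2≡2*count-meets-1 m r ⟩
  2 * count (meets 1) (3 + m) r    ≡⟨ cong (2 *_) (sym (N≡count-meets 0 (2 + m) r)) ⟩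
  2 * N 0 (3 + m) r                ∎
  where open ≡-Reasoning
mainTheorem4 (suc zero)       r (s≤s ()) _
mainTheorem4 (suc (suc zero)) r (s≤s (s≤s ())) _
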